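{- For all integers $b \geq 2$ and $r \geq 2$, \[N(1,b;r) \geq 2b^r+5b^{r-1}+6b^{r-2}+2\sum_{i=0}^{r-3} b^i.\] (An inequality $N(1,b;r) \geq M$ means that there is an $r$-coloring of $[1,M-1]$ with no monochromatic $(1,b)$-triple; it holds trivially if $N(1,b;r)$ does not exist.)
   Context: $\mathbf{N}=\{1,2,3,\dots\}$ and $[1,n]=\{1,2,\dots,n\}$. For integers $1 \leq a \leq b$, an $(a,b)$-triple is a set of the form $\{x,ax+d,bx+2d\}$ with $x,d \in \mathbf{N}$; a $(1,b)$-triple is $\{x,x+d,bx+2d\}$. $N(a,b;r)$ is the least positive integer, if it exists, such that every $r$-coloring of $[1,N(a,b;r)]$ contains a monochromatic $(a,b)$-triple. An empty sum equals $0$. -}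

module Defs where

open import Data.Nat using (ℕ; zero; suc; _+_; _*_; _∸_; _^_; _≤_; _<_)
open import Data.Fin using (Fin)
open import Data.Product using (Σ; _×_; ∃-syntax)
open import Relation.Binary.PropositionalEquality using (_≡_)
open import Relation.Nullary using (¬_)

sumBelow : ℕ → (ℕ → ℕ) → ℕ
sumBelow zero    f = 0
sumBelow (suc n) f = sumBelow n f + f n

-- An r-coloring of [1,n]: a map ℕ → Fin r; only its values on [1,n] matter.
Coloring : ℕ → Set
Coloring r = ℕ → Fin r

MonoTriple : ℕ → ℕ → ℕ → (r : ℕ) → Coloring r → Set
MonoTriple a b n r χ =
  ∃[ x ] ∃[ d ] (1 ≤ x × 1 ≤ d × x ≤ n × a * x + d ≤ n × b * x + 2 * d ≤ n
                × χ x ≡ χ (a * x + d) × χ x ≡ χ (b * x + 2 * d))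

NLowerBound : ℕ → ℕ → ℕ → ℕ → Set
NLowerBound a b r M = ∃[ χ ] ¬ MonoTriple a b (M ∸ 1) r χ

boundM : ℕ → ℕ → ℕ
boundM b r = 2 * b ^ r + 5 * b ^ (r ∸ 1) + 6 * b ^ (r ∸ 2) + 2 * sumBelow (r ∸ 2) (λ i → b ^ i)

-- For r = 2 and b = 2 + c, colour {b+2} ∪ [b+4, b²+2b+3] with one colour and the rest of
-- [1, 2b²+5b+5] with the other. Writing a triple as x < y < z with z = c x + 2 y, three
-- elements of the first class force z ≥ b²+2b+4. In the second class, y ≤ b+3 puts z in
-- [b+2, b²+2b+2], whose only candidate b+3 = c x + 2 y has no solution, and y ≥ b²+2b+4
-- pushes z beyond 2b²+5b+5.
-- From r to r + 1: if [1, m] is coloured without monochromatic triples, give all of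
-- [m+1, b(m+1)+1] a new colour; a triple with x ≥ m + 1 has z ≥ b(m+1)+2. This turns the
-- bound M into 2 + bM, which is exactly how boundM b r grows with r.
module Submission where

open import Defs
open import Data.Nat using (ℕ; zero; suc; _+_; _*_; _∸_; _^_; _≤_; _<_; z≤n; s≤s; _≤?_; _≟_)
open import Data.Nat.Properties
open import Data.Nat.Tactic.RingSolver using (solve-∀)
import Data.Fin as Fin
import Data.Fin.Properties as Fin
open import Data.Product using (_×_; _,_)
open import Data.Sum using (_⊎_; inj₁; inj₂)
open import Data.Empty using (⊥)
open import Relation.Nullary using (¬_; Dec; yes; no; contradiction)
open import Relation.Nullary.Decidable using (_⊎-dec_; _×-dec_)
open import Relation.Binary.PropositionalEquality

sumBelow-geometric-suc : ∀ b k → sumBelow (suc k) (b ^_) ≡ 1 + b * sumBelow k (b ^_)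
sumBelow-geometric-suc b zero    = cong suc (sym (*-zeroʳ b))
sumBelow-geometric-suc b (suc k) = begin
  sumBelow (suc k) (b ^_) + b ^ suc k        ≡⟨ cong (_+ b ^ suc k) (sumBelow-geometric-suc b k) ⟩
  1 + b * sumBelow k (b ^_) + b * b ^ k      ≡⟨ cong suc (sym (*-distribˡ-+ b _ (b ^ k))) ⟩
  1 + b * (sumBelow k (b ^_) + b ^ k)        ∎
  where open ≡-Reasoning

boundM-two : ∀ b → boundM b 2 ≡ suc (2 * (b * b) + 5 * b + 5)
boundM-two b = unfolded b
  where
  unfolded : ∀ b → 2 * (b * (b * 1)) + 5 * (b * 1) + 6 * 1 + 2 * 0 ≡ suc (2 * (b * b) + 5 * b + 5)
  unfolded = solve-∀

boundM-suc : ∀ b k → boundM b (3 + k) ≡ 2 + b * boundM b (2 + k)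
boundM-suc b k = begin
  2 * (b * (b * (b * p))) + 5 * (b * (b * p)) + 6 * (b * p) + 2 * sumBelow (suc k) (b ^_)
    ≡⟨ cong (λ s → 2 * (b * (b * (b * p))) + 5 * (b * (b * p)) + 6 * (b * p) + 2 * s)
            (sumBelow-geometric-suc b k) ⟩
  2 * (b * (b * (b * p))) + 5 * (b * (b * p)) + 6 * (b * p) + 2 * (1 + b * s)
    ≡⟨ factor b p s ⟩
  2 + b * boundM b (2 + k) ∎
  where
  open ≡-Reasoning
  p = b ^ k
  s = sumBelow k (b ^_)
  factor : ∀ b p s → 2 * (b * (b * (b * p))) + 5 * (b * (b * p)) + 6 * (b * p) + 2 * (1 + b * s)
                   ≡ 2 + b * (2 * (b * (b * p)) + 5 * (b * p) + 6 * p + 2 * s)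
  factor = solve-∀

extendColoring : ∀ {r} → Coloring r → ℕ → Coloring (suc r)
extendColoring χ m z with z ≤? m
... | yes _ = Fin.suc (χ z)
... | no  _ = Fin.zero

extendColoring-≤ : ∀ {r} (χ : Coloring r) {m z} → z ≤ m → extendColoring χ m z ≡ Fin.suc (χ z)
extendColoring-≤ χ {m} {z} z≤m with z ≤? m
... | yes _   = refl
... | no  z≰m = contradiction z≤m z≰m

extendColoring-below : ∀ {r} (χ : Coloring r) {m x y} → x ≤ m →
                       extendColoring χ m x ≡ extendColoring χ m y → y ≤ m × χ x ≡ χ y
extendColoring-below χ {m} {x} {y} x≤m x~y with y ≤? m | trans (sym (extendColoring-≤ χ x≤m)) x~y
... | yes y≤m | eq = y≤m , Fin.suc-injective eq
... | no  _   | ()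

nLowerBound-extend : ∀ b {r M} → NLowerBound 1 b r M → NLowerBound 1 b (suc r) (2 + b * M)
nLowerBound-extend b {r} {M} (χ , free) = extendColoring χ m , extended-free
  where
  m = M ∸ 1
  extended-free : ¬ MonoTriple 1 b (suc (b * M)) (suc r) (extendColoring χ m)
  extended-free (x , d , 1≤x , 1≤d , _ , _ , z≤ , x~y , x~z) with ≤-<-connex x m
  ... | inj₁ x≤m
    with y≤m , χx≡χy ← extendColoring-below χ x≤m x~y
       | z≤m , χx≡χz ← extendColoring-below χ x≤m x~z
    = free (x , d , 1≤x , 1≤d , x≤m , y≤m , z≤m , χx≡χy , χx≡χz)
  ... | inj₂ m<x = <⇒≱ z-large z≤
    where
    z-large : 2 + b * M ≤ b * x + 2 * d
    z-large = subst (_≤ b * x + 2 * d) (+-comm (b * M) 2)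
      (+-mono-≤ (*-monoʳ-≤ b (≤-trans (m≤n+m∸n M 1) m<x)) (*-monoʳ-≤ 2 1≤d))

upperTop : ℕ → ℕ
upperTop c = c * c + 6 * c + 11

-- With b = 2 + c this is {b+2} ∪ [b+4, b²+2b+3].
Upper : ℕ → ℕ → Set
Upper c z = z ≡ 4 + c ⊎ (6 + c ≤ z × z ≤ upperTop c)

upper? : ∀ c z → Dec (Upper c z)
upper? c z = (z ≟ 4 + c) ⊎-dec ((6 + c ≤? z) ×-dec (z ≤? upperTop c))

baseColoring : ℕ → Coloring 2
baseColoring c z with upper? c z
... | yes _ = Fin.suc Fin.zero
... | no  _ = Fin.zero

baseColoring-sameClass : ∀ c {x y} → baseColoring c x ≡ baseColoring c y →
                         (Upper c x × Upper c y) ⊎ (¬ Upper c x × ¬ Upper c y)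
baseColoring-sameClass c {x} {y} eq with upper? c x | upper? c y
... | yes ux | yes uy = inj₁ (ux , uy)
... | no ¬ux | no ¬uy = inj₂ (¬ux , ¬uy)
baseColoring-sameClass c () | yes _ | no _
baseColoring-sameClass c () | no _  | yes _

upper-≥ : ∀ c {z} → Upper c z → 4 + c ≤ z
upper-≥ c (inj₁ refl)        = ≤-refl
upper-≥ c (inj₂ (6+c≤z , _)) = ≤-trans (m≤n+m (4 + c) 2) 6+c≤z

upper-≤ : ∀ c {z} → Upper c z → z ≤ upperTop c
upper-≤ c (inj₁ refl)     = ≤-trans (m≤m+n (4 + c) (c * c + 5 * c + 7)) (≤-reflexive (regroup c))
  where
  regroup : ∀ c → 4 + c + (c * c + 5 * c + 7) ≡ c * c + 6 * c + 11
  regroup = solve-∀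
upper-≤ c (inj₂ (_ , z≤)) = z≤

¬upper-cases : ∀ c {z} → ¬ Upper c z → z ≤ 3 + c ⊎ z ≡ 5 + c ⊎ upperTop c < z
¬upper-cases c {z} ¬uz with ≤-<-connex z (3 + c)
... | inj₁ z≤3+c = inj₁ z≤3+c
... | inj₂ 3+c<z with m≤n⇒m<n∨m≡n 3+c<z
...   | inj₂ refl = contradiction (inj₁ refl) ¬uz
...   | inj₁ 4+c<z with m≤n⇒m<n∨m≡n 4+c<z
...     | inj₂ refl = inj₂ (inj₁ refl)
...     | inj₁ 5+c<z with ≤-<-connex z (upperTop c)
...       | inj₁ z≤top = contradiction (inj₂ (5+c<z , z≤top)) ¬uz
...       | inj₂ top<z = inj₂ (inj₂ top<z)

c*x+2*y-mono-≤ : ∀ c {x x′ y y′} → x ≤ x′ → y ≤ y′ → c * x + 2 * y ≤ c * x′ + 2 * y′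
c*x+2*y-mono-≤ c x≤x′ y≤y′ = +-mono-≤ (*-monoʳ-≤ c x≤x′) (*-monoʳ-≤ 2 y≤y′)

c*1+2*2≡4+c : ∀ c → c * 1 + 2 * 2 ≡ 4 + c
c*1+2*2≡4+c = solve-∀

c*x+2*y≢5+c : ∀ c {x y} → 1 ≤ x → x < y → c * x + 2 * y ≢ 5 + c
c*x+2*y≢5+c c {x} {suc (suc (suc y))} 1≤x _ eq =
  <-irrefl (sym eq) (≤-trans (≤-reflexive (sym (six c))) (c*x+2*y-mono-≤ c 1≤x (m≤m+n 3 y)))
  where
  six : ∀ c → c * 1 + 2 * 3 ≡ 6 + c
  six = solve-∀
c*x+2*y≢5+c c {suc _}       {1} _ (s≤s ())       _
c*x+2*y≢5+c c {suc (suc _)} {2} _ (s≤s (s≤s ())) _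
c*x+2*y≢5+c c {1} {2} _ _ eq = <-irrefl (trans (sym (c*1+2*2≡4+c c)) eq) ≤-refl

upper-triple-top : ∀ c {x y} → Upper c x → Upper c y → x < y → upperTop c < c * x + 2 * y
upper-triple-top c {x} {y} ux uy x<y =
  ≤-trans (≤-reflexive (sym (just-above c))) (c*x+2*y-mono-≤ c (upper-≥ c ux) (6+c≤y uy))
  where
  just-above : ∀ c → c * (4 + c) + 2 * (6 + c) ≡ 1 + (c * c + 6 * c + 11)
  just-above = solve-∀
  6+c≤y : Upper c y → 6 + c ≤ y
  6+c≤y (inj₁ refl)        = contradiction (upper-≥ c ux) (<⇒≱ x<y)
  6+c≤y (inj₂ (6+c≤y , _)) = 6+c≤y

c*x+2*y-upper : ∀ c {x y} → 1 ≤ x → x < y → y ≤ 5 + c → Upper c (c * x + 2 * y)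
c*x+2*y-upper c {x} {y} 1≤x x<y y≤5+c with upper? c (c * x + 2 * y)
... | yes uz = uz
... | no ¬uz with ¬upper-cases c ¬uz
...   | inj₁ z≤3+c        = contradiction z≤3+c (<⇒≱ z-lower)
  where
  z-lower : 4 + c ≤ c * x + 2 * y
  z-lower = ≤-trans (≤-reflexive (sym (c*1+2*2≡4+c c))) (c*x+2*y-mono-≤ c 1≤x (≤-trans (s≤s 1≤x) x<y))
...   | inj₂ (inj₁ z≡5+c) = contradiction z≡5+c (c*x+2*y≢5+c c 1≤x x<y)
...   | inj₂ (inj₂ top<z) = contradiction top<z (≤⇒≯ z-upper)
  where
  below-top : ∀ c → c * (4 + c) + 2 * (5 + c) + 1 ≡ c * c + 6 * c + 11
  below-top = solve-∀
  z-upper : c * x + 2 * y ≤ upperTop c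
  z-upper = ≤-trans (c*x+2*y-mono-≤ c (≤-pred (≤-trans x<y y≤5+c)) y≤5+c)
                    (≤-trans (m≤m+n _ 1) (≤-reflexive (below-top c)))

lower-triple-top : ∀ c {x y} → 1 ≤ x → x < y → ¬ Upper c y → ¬ Upper c (c * x + 2 * y) →
                   2 * (c * c) + 13 * c + 23 < c * x + 2 * y
lower-triple-top c {x} {y} 1≤x x<y ¬uy ¬uz with ¬upper-cases c ¬uy
... | inj₁ y≤3+c        = contradiction (c*x+2*y-upper c 1≤x x<y (≤-trans y≤3+c (m≤n+m _ 2))) ¬uz
... | inj₂ (inj₁ refl)  = contradiction (c*x+2*y-upper c 1≤x x<y ≤-refl) ¬uz
... | inj₂ (inj₂ top<y) =
  ≤-trans (≤-reflexive (sym (just-above c))) (c*x+2*y-mono-≤ c 1≤x top<y)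
  where
  just-above : ∀ c → c * 1 + 2 * (1 + (c * c + 6 * c + 11)) ≡ 1 + (2 * (c * c) + 13 * c + 23)
  just-above = solve-∀

baseColoring-free : ∀ c → ¬ MonoTriple 1 (2 + c) (2 * ((2 + c) * (2 + c)) + 5 * (2 + c) + 5) 2 (baseColoring c)
baseColoring-free c (x , d , 1≤x , 1≤d , _ , _ , z≤ , x~y , x~z) =
  classes-absurd (baseColoring-sameClass c x~y)
                 (baseColoring-sameClass c (trans x~z (cong (baseColoring c) (shape c x d))))
  where
  y = 1 * x + d
  z = c * x + 2 * y
  shape : ∀ c x d → (2 + c) * x + 2 * d ≡ c * x + 2 * (1 * x + d)
  shape = solve-∀
  bound : ∀ c → 2 * ((2 + c) * (2 + c)) + 5 * (2 + c) + 5 ≡ 2 * (c * c) + 13 * c + 23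
  bound = solve-∀
  x<y : x < y
  x<y = subst (x <_) (cong (_+ d) (sym (*-identityˡ x))) (m<m+n x 1≤d)
  z≤top : z ≤ 2 * (c * c) + 13 * c + 23
  z≤top = subst (_≤ 2 * (c * c) + 13 * c + 23) (shape c x d) (≤-trans z≤ (≤-reflexive (bound c)))
  classes-absurd : (Upper c x × Upper c y) ⊎ (¬ Upper c x × ¬ Upper c y) →
                   (Upper c x × Upper c z) ⊎ (¬ Upper c x × ¬ Upper c z) → ⊥
  classes-absurd (inj₁ (ux , uy))  (inj₁ (_ , uz))  = <⇒≱ (upper-triple-top c ux uy x<y) (upper-≤ c uz)
  classes-absurd (inj₂ (_ , ¬uy))  (inj₂ (_ , ¬uz)) = <⇒≱ (lower-triple-top c 1≤x x<y ¬uy ¬uz) z≤top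
  classes-absurd (inj₁ (ux , _))   (inj₂ (¬ux , _)) = ¬ux ux
  classes-absurd (inj₂ (¬ux , _))  (inj₁ (ux , _))  = ¬ux ux

nLowerBound-boundM : ∀ c k → NLowerBound 1 (2 + c) (2 + k) (boundM (2 + c) (2 + k))
nLowerBound-boundM c zero    =
  subst (NLowerBound 1 (2 + c) 2) (sym (boundM-two (2 + c))) (baseColoring c , baseColoring-free c)
nLowerBound-boundM c (suc k) =
  subst (NLowerBound 1 (2 + c) (3 + k)) (sym (boundM-suc (2 + c) k))
        (nLowerBound-extend (2 + c) {M = boundM (2 + c) (2 + k)} (nLowerBound-boundM c k))

proposition3p2 : (b r : ℕ) → 2 ≤ b → 2 ≤ r → NLowerBound 1 b r (boundM b r)
proposition3p2 (suc (suc c)) (suc (suc k)) (s≤s (s≤s z≤n)) (s≤s (s≤s z≤n)) = nLowerBound-boundM c k
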